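{- Let $n>1$ be an integer. There exists a dually vertex-oblique graph on $n$ vertices if and only if $n \equiv 0$ or $1 \pmod 4$ and $n \geq 8$.
   Context: All graphs are finite and simple. For a vertex $v$ of degree $r$ in a graph $G$ whose neighbours have degrees $x_1 \geq \cdots \geq x_r$ (degrees taken in $G$), the vertex type of $v$ in $G$ is the sequence $t(v) := (x_1,\ldots,x_r)$. A graph is vertex-oblique if distinct vertices have distinct vertex types. A graph $G$ is dually vertex-oblique if it is vertex-oblique and the set of vertex types of $G$ equals the set of vertex types of its complement $\overline{G}$ (where vertex types in $\overline{G}$ are computed using degrees and adjacencies in $\overline{G}$). -}

module Defs where

open import Data.Bool using (Bool; true; false; not; if_then_else_; T)
open import Data.Nat using (ℕ; zero; suc)
open import Data.Nat.Properties using (≤-decTotalOrder)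
open import Data.Fin using (Fin; _≟_)
open import Data.List using (List; []; _∷_; map; filterᵇ; length; allFin)
open import Data.Product using (Σ; _×_; ∃; ∃-syntax)
open import Relation.Nullary using (¬_; does; yes; no)
open import Data.Empty using (⊥-elim)
open import Relation.Binary.PropositionalEquality using (_≡_; refl; cong) renaming (sym to ≡-sym)
import Relation.Binary.Construct.Flip.EqAndOrd as Flip
import Data.List.Sort.InsertionSort.Base as InsSort

record Graph (n : ℕ) : Set where
  field
    adj   : Fin n → Fin n → Bool
    sym   : ∀ u v → adj u v ≡ adj v u
    irrefl : ∀ v → adj v v ≡ false
open Graph public

complement : ∀ {n} → Graph n → Graph n
complement {n} G = record { adj = cadj ; sym = csym ; irrefl = cirr }
  where
  cadj : Fin n → Fin n → Bool
  cadj u v = if does (u ≟ v) then false else not (adj G u v)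
  csym : ∀ u v → cadj u v ≡ cadj v u
  csym u v with u ≟ v | v ≟ u
  ... | yes _ | yes _ = refl
  ... | yes p | no q = ⊥-elim (q (≡-sym p))
  ... | no p | yes q = ⊥-elim (p (≡-sym q))
  ... | no _ | no _ = cong not (sym G u v)
  cirr : ∀ v → cadj v v ≡ false
  cirr v with v ≟ v
  ... | yes _ = refl
  ... | no p = ⊥-elim (p refl)

neighbours : ∀ {n} → Graph n → Fin n → List (Fin n)
neighbours {n} G v = filterᵇ (adj G v) (allFin n)

degree : ∀ {n} → Graph n → Fin n → ℕ
degree G v = length (neighbours G v)

sortDesc : List ℕ → List ℕ
sortDesc = InsSort.sort (Flip.decTotalOrder ≤-decTotalOrder)

vertexType : ∀ {n} → Graph n → Fin n → List ℕ
vertexType G v = sortDesc (map (degree G) (neighbours G v))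

VertexOblique : ∀ {n} → Graph n → Set
VertexOblique {n} G = ∀ (u v : Fin n) → ¬ (u ≡ v) → ¬ (vertexType G u ≡ vertexType G v)

DuallyVertexOblique : ∀ {n} → Graph n → Set
DuallyVertexOblique {n} G =
  VertexOblique G
  × (∀ (u : Fin n) → ∃[ w ] vertexType G u ≡ vertexType (complement G) w)
  × (∀ (w : Fin n) → ∃[ u ] vertexType (complement G) w ≡ vertexType G u)

{-# OPTIONS --safe #-}
-- Necessity. If G is dually vertex-oblique, the map sending a vertex of G to a
-- vertex of the complement with the same type is injective because G is
-- vertex-oblique, hence a bijection, so G and its complement have the same degrees.
-- Their degree sums are therefore equal, even, and add up to n(n − 1), so 4 divides
-- n(n − 1), that is n ≡ 0, 1 (mod 4). For 1 < n < 8 this leaves n = 4, 5, where an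
-- exhaustive search finds no vertex-oblique graph at all.
--
-- Sufficiency. Dually vertex-oblique graphs on 8, 9, 12 and 13 vertices are checked
-- by computation, and a fixed 8-vertex gadget F with a four-element set J of
-- vertices raises the order by 8: glue F to G, joining J to every vertex of G. The
-- type of an old vertex is its type in G shifted by |J|, together with the degrees
-- of J; gadget vertices differ from old ones in degree, and from each other in
-- membership in J, degree in F, or number of neighbours in J. The complement of the
-- glued graph is the complement of F glued along the complement of J onto the
-- complement of G, and a bijection π of V(F) matching the neighbourhood profiles
-- (membership in J, degree) in F with those in the complement of F carries the type
-- correspondence of G over to the glued graph.

module Submission where

open import Defs
open import Data.Bool using (Bool; true; false; not; if_then_else_; T; T?)
import Data.Bool.Properties as Bool
open import Data.Empty using (⊥-elim)
open import Data.Fin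
  using (Fin; zero; suc; toℕ; _↑ˡ_; _↑ʳ_; splitAt; join; punchOut; _≟_)
import Data.Fin as Fin
open import Data.Fin.Patterns using (0F; 1F; 2F; 3F; 4F; 5F; 6F; 7F)
open import Data.Fin.Properties
  using (any?; all?; injective⇒≤; punchOut-injective; splitAt-↑ˡ; splitAt-↑ʳ; join-splitAt; ↑ˡ-injective; ↑ʳ-injective)
open import Data.List using (List; []; _∷_; _++_; map; filterᵇ; length; allFin; tabulate; reverse)
open import Data.List.Properties as List
  using (length-map; length-++; length-tabulate; map-∘; map-cong; map-++; map-tabulate; filter-notAll; filter-++; ≡-dec)
open import Data.List.Membership.Propositional using (_∈_)
open import Data.List.Membership.Propositional.Properties using (∈-allFin; ∈-map⁺)
open import Data.List.Membership.Propositional.Properties.WithK using (unique∧set⇒bag)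
open import Data.List.Relation.Binary.BagAndSetEquality using (∼bag⇒↭)
open import Data.List.Relation.Binary.Permutation.Propositional
  using (_↭_; ↭-refl; ↭-sym; ↭-trans; ↭-reflexive; ↭⇒↭ₛ; module PermutationReasoning)
open import Data.List.Relation.Binary.Permutation.Propositional.Properties
  using (map⁺; ++⁺; drop-∷; ↭-length; ↭-reverse; filter-↭; ++-comm)
open import Data.List.Relation.Binary.Pointwise using (Pointwise-≡⇒≡)
import Data.List.Relation.Unary.Any as Any
import Data.List.Relation.Unary.Sorted.TotalOrder.Properties as Sorted
import Data.List.Relation.Unary.Unique.Propositional.Properties as Unique
import Data.List.Sort.InsertionSort.Properties as InsertionSort
open import Data.Nat using (ℕ; zero; suc; _+_; _*_; _∸_; _/_; _%_; _<ᵇ_; _≤_; _<_; z≤n; s≤s)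
open import Data.Nat.DivMod using ([m+kn]%n≡m%n; %-distribˡ-*; m%n<n; m≡m%n+[m/n]*n)
import Data.Nat.ListAction as ListAction
open import Data.Nat.ListAction.Properties using (sum-↭)
open import Data.Nat.Properties as ℕ using (≤-decTotalOrder; +-0-commutativeMonoid; m+n∸m≡n)
open import Algebra.Properties.CommutativeMonoid.Sum +-0-commutativeMonoid
  using (sum-syntax; ∑-distrib-+; sum-cong-≗)
open import Data.Nat.Tactic.RingSolver using (solve-∀)
open import Data.Product using (_×_; _,_; proj₁; proj₂; ∃-syntax)
import Data.Product.Properties as Product
open import Data.Sum using (_⊎_; inj₁; inj₂)
open import Data.Vec using (Vec; []; _∷_; lookup)
import Data.Vec as Vec
open import Data.Vec.Properties using (lookup∘tabulate)
open import Function using (_∘_; id; Injective)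
open import Function.Bundles using (_⇔_; mk⇔)
open import Relation.Binary.PropositionalEquality
  using (_≡_; refl; cong; cong₂; subst; _≗_; module ≡-Reasoning)
  renaming (sym to ≡-sym; trans to ≡-trans)
import Relation.Binary.Construct.Flip.EqAndOrd as Flip
open import Relation.Nullary using (¬_; Dec; yes; no; does; ¬?; _×-dec_; _→-dec_)
open import Relation.Nullary.Decidable
  using (True; toWitness; from-yes; map′; does-⇔; dec-true; dec-false)

private
  variable
    A B : Set
    k n : ℕ

-- Lists and permutations

private
  module Sort = InsertionSort (Flip.decTotalOrder ≤-decTotalOrder)

sortDesc-↭ : (xs : List ℕ) → sortDesc xs ↭ xs
sortDesc-↭ = Sort.sort-↭

↭⇒sortDesc-≡ : {xs ys : List ℕ} → xs ↭ ys → sortDesc xs ≡ sortDesc ys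
↭⇒sortDesc-≡ {xs} {ys} xs↭ys = Pointwise-≡⇒≡
  (Sorted.↗↭↗⇒≋ (Flip.totalOrder ℕ.≤-totalOrder) (Sort.sort-↗ xs) (Sort.sort-↗ ys)
    (↭⇒↭ₛ (↭-trans (sortDesc-↭ xs) (↭-trans xs↭ys (↭-sym (sortDesc-↭ ys))))))

sortDesc-≡⇒↭ : {xs ys : List ℕ} → sortDesc xs ≡ sortDesc ys → xs ↭ ys
sortDesc-≡⇒↭ {xs} {ys} eq =
  ↭-trans (↭-sym (sortDesc-↭ xs)) (↭-trans (↭-reflexive eq) (sortDesc-↭ ys))

filterᵇ-map : (p : B → Bool) (f : A → B) (xs : List A) →
  filterᵇ p (map f xs) ≡ map f (filterᵇ (p ∘ f) xs)
filterᵇ-map p f [] = refl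
filterᵇ-map p f (x ∷ xs) with p (f x)
... | true = cong (f x ∷_) (filterᵇ-map p f xs)
... | false = filterᵇ-map p f xs

filterᵇ-cong : {p q : A → Bool} → p ≗ q → filterᵇ p ≗ filterᵇ q
filterᵇ-cong p≗q [] = refl
filterᵇ-cong {q = q} p≗q (x ∷ xs) rewrite p≗q x with q x
... | true = cong (x ∷_) (filterᵇ-cong p≗q xs)
... | false = filterᵇ-cong p≗q xs

filterᵇ-const : (b : Bool) (xs : List A) → filterᵇ (λ _ → b) xs ≡ (if b then xs else [])
filterᵇ-const true [] = refl
filterᵇ-const true (x ∷ xs) = cong (x ∷_) (filterᵇ-const true xs)
filterᵇ-const false [] = refl
filterᵇ-const false (x ∷ xs) = filterᵇ-const false xs

length-if : (b : Bool) (xs : List A) → length (if b then xs else []) ≡ (if b then length xs else 0)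
length-if true xs = refl
length-if false xs = refl

tabulate-+ : ∀ m (f : Fin (m + n) → A) →
  tabulate f ≡ tabulate (f ∘ (_↑ˡ n)) ++ tabulate (f ∘ (m ↑ʳ_))
tabulate-+ zero f = refl
tabulate-+ (suc m) f = cong (f zero ∷_) (tabulate-+ m (f ∘ suc))

allFin-+ : ∀ m n → allFin (m + n) ≡ map (_↑ˡ n) (allFin m) ++ map (m ↑ʳ_) (allFin n)
allFin-+ m n = ≡-trans (tabulate-+ m id)
  (≡-sym (cong₂ _++_ (map-tabulate id (_↑ˡ n)) (map-tabulate id (m ↑ʳ_))))

≡-reverse⇒↭ : {xs ys : List A} → xs ≡ reverse ys → xs ↭ ys
≡-reverse⇒↭ {ys = ys} xs≡ys = ↭-trans (↭-reflexive xs≡ys) (↭-reverse ys)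

++-cancelˡ-↭ : (xs : List A) {ys zs : List A} → xs ++ ys ↭ xs ++ zs → ys ↭ zs
++-cancelˡ-↭ [] p = p
++-cancelˡ-↭ (x ∷ xs) p = ++-cancelˡ-↭ xs (drop-∷ p)

++-cancelʳ-↭ : {xs ys : List A} (zs : List A) → xs ++ zs ↭ ys ++ zs → xs ↭ ys
++-cancelʳ-↭ {xs = xs} {ys} zs p =
  ++-cancelˡ-↭ zs (↭-trans (++-comm zs xs) (↭-trans p (++-comm ys zs)))

map-+-cancel-↭ : ∀ c {xs ys : List ℕ} → map (c +_) xs ↭ map (c +_) ys → xs ↭ ys
map-+-cancel-↭ c {xs} {ys} p = ↭-trans (↭-reflexive (≡-sym (unshift xs)))
  (↭-trans (map⁺ (_∸ c) p) (↭-reflexive (unshift ys)))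
  where
  unshift : ∀ zs → map (_∸ c) (map (c +_) zs) ≡ zs
  unshift zs = ≡-trans (≡-sym (map-∘ zs)) (≡-trans (map-cong (m+n∸m≡n c) zs) (List.map-id zs))

injective⇒surjective : (f : Fin n → Fin n) → Injective _≡_ _≡_ f → ∀ z → ∃[ u ] f u ≡ z
injective⇒surjective {zero} f f-inj ()
injective⇒surjective {suc n} f f-inj z with any? (λ u → f u ≟ z)
... | yes hit = hit
... | no miss = ⊥-elim (ℕ.1+n≰n (injective⇒≤ g-inj))
  where
  z≢f : ∀ u → ¬ z ≡ f u
  z≢f u z≡fu = miss (u , ≡-sym z≡fu)
  g : Fin (suc n) → Fin n
  g u = punchOut (z≢f u)
  g-inj : Injective _≡_ _≡_ g
  g-inj {x} {y} = f-inj ∘ punchOut-injective (z≢f x) (z≢f y)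

map-allFin-↭ : (f : Fin n → Fin n) → Injective _≡_ _≡_ f → map f (allFin n) ↭ allFin n
map-allFin-↭ {n} f f-inj = ∼bag⇒↭ (unique∧set⇒bag
  (Unique.map⁺ f-inj (Unique.allFin⁺ n)) (Unique.allFin⁺ n)
  (λ {z} → mk⇔ (λ _ → ∈-allFin z) (λ _ → hit z)))
  where
  hit : ∀ z → z ∈ map f (allFin n)
  hit z with u , fu≡z ← injective⇒surjective f f-inj z =
    subst (_∈ map f (allFin n)) fu≡z (∈-map⁺ f (∈-allFin u))

-- Degrees and vertex types

degree<n : (G : Graph n) (v : Fin n) → degree G v < n
degree<n {n} G v = subst (degree G v <_) (length-tabulate id)
  (filter-notAll (T? ∘ adj G v) (allFin n) (Any.map (λ { refl → subst T (irrefl G v) }) (∈-allFin v)))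

infix 4 _≈ᴳ_

record _≈ᴳ_ (G H : Graph n) : Set where
  constructor same-adj
  field adj-≡ : ∀ u v → adj G u v ≡ adj H u v
open _≈ᴳ_

≈ᴳ-refl : (G : Graph n) → G ≈ᴳ G
≈ᴳ-refl G = same-adj λ u v → refl

≈ᴳ-sym : {G H : Graph n} → G ≈ᴳ H → H ≈ᴳ G
≈ᴳ-sym G≈H = same-adj λ u v → ≡-sym (adj-≡ G≈H u v)

≈ᴳ-trans : {G H K : Graph n} → G ≈ᴳ H → H ≈ᴳ K → G ≈ᴳ K
≈ᴳ-trans G≈H H≈K = same-adj λ u v → ≡-trans (adj-≡ G≈H u v) (adj-≡ H≈K u v)

module _ {G H : Graph n} (G≈H : G ≈ᴳ H) where

  neighbours-cong : ∀ v → neighbours G v ≡ neighbours H v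
  neighbours-cong v = filterᵇ-cong (adj-≡ G≈H v) (allFin n)

  degree-cong : ∀ v → degree G v ≡ degree H v
  degree-cong v = cong length (neighbours-cong v)

  vertexType-cong : ∀ v → vertexType G v ≡ vertexType H v
  vertexType-cong v rewrite neighbours-cong v =
    cong sortDesc (map-cong degree-cong (neighbours H v))

  vertexOblique-cong : VertexOblique G → VertexOblique H
  vertexOblique-cong voG u v u≢v eq =
    voG u v u≢v (≡-trans (vertexType-cong u) (≡-trans eq (≡-sym (vertexType-cong v))))

length-vertexType : (G : Graph n) (v : Fin n) → length (vertexType G v) ≡ degree G v
length-vertexType G v =
  ≡-trans (↭-length (sortDesc-↭ (map (degree G) (neighbours G v)))) (length-map (degree G) (neighbours G v))

vertexType-≡⇒degree-≡ : (G H : Graph n) {u v : Fin n} →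
  vertexType G u ≡ vertexType H v → degree G u ≡ degree H v
vertexType-≡⇒degree-≡ G H {u} {v} eq =
  ≡-trans (≡-sym (length-vertexType G u)) (≡-trans (cong length eq) (length-vertexType H v))

-- Degree sums

indicator : Bool → ℕ
indicator b = if b then 1 else 0

length-filterᵇ-∷ : (p : A → Bool) (x : A) (xs : List A) →
  length (filterᵇ p (x ∷ xs)) ≡ indicator (p x) + length (filterᵇ p xs)
length-filterᵇ-∷ p x xs with p x
... | true = refl
... | false = refl

length-filterᵇ-allFin : (p : Fin n → Bool) →
  length (filterᵇ p (allFin n)) ≡ ∑[ i < n ] indicator (p i)
length-filterᵇ-allFin {zero} p = refl
length-filterᵇ-allFin {suc n} p = begin
  length (filterᵇ p (zero ∷ tabulate suc))              ≡⟨ length-filterᵇ-∷ p zero _ ⟩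
  indicator (p zero) + length (filterᵇ p (tabulate suc))
    ≡⟨ cong (λ xs → indicator (p zero) + length (filterᵇ p xs)) (map-tabulate id suc) ⟨
  indicator (p zero) + length (filterᵇ p (map suc (allFin n)))
    ≡⟨ cong (λ xs → indicator (p zero) + length xs) (filterᵇ-map p suc (allFin n)) ⟩
  indicator (p zero) + length (map suc (filterᵇ (p ∘ suc) (allFin n)))
    ≡⟨ cong (indicator (p zero) +_) (≡-trans (length-map Fin.suc (filterᵇ (p ∘ suc) (allFin n))) (length-filterᵇ-allFin (p ∘ suc))) ⟩
  indicator (p zero) + ∑[ i < n ] indicator (p (suc i))  ∎
  where open ≡-Reasoning

∑-const : ∀ n c → ∑[ i < n ] c ≡ n * c
∑-const zero c = refl
∑-const (suc n) c = cong (c +_) (∑-const n c)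

∑-1 : ∀ n → ∑[ i < n ] 1 ≡ n
∑-1 n = ≡-trans (∑-const n 1) (ℕ.*-identityʳ n)

sum-tabulate : (f : Fin n → ℕ) → ListAction.sum (tabulate f) ≡ ∑[ i < n ] f i
sum-tabulate {zero} f = refl
sum-tabulate {suc n} f = cong (f zero +_) (sum-tabulate (f ∘ suc))

sum-map-allFin : (f : Fin n → ℕ) → ListAction.sum (map f (allFin n)) ≡ ∑[ i < n ] f i
sum-map-allFin f = ≡-trans (cong ListAction.sum (map-tabulate id f)) (sum-tabulate f)

restrict : Graph (suc n) → Graph n
restrict G = record
  { adj = λ u v → adj G (suc u) (suc v)
  ; sym = λ u v → sym G (suc u) (suc v)
  ; irrefl = λ v → irrefl G (suc v)
  }

degree≡∑ : (G : Graph n) (v : Fin n) → degree G v ≡ ∑[ w < n ] indicator (adj G v w)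
degree≡∑ G v = length-filterᵇ-allFin (adj G v)

handshake : (G : Graph n) → ∃[ e ] ∑[ u < n ] ∑[ v < n ] indicator (adj G u v) ≡ e + e
handshake {zero} G = 0 , refl
handshake {suc n} G with e , restricted≡e+e ← handshake (restrict G) = r + e , (begin
  (indicator (adj G zero zero) + r) + ∑[ u < n ] (indicator (adj G (suc u) zero) + S u)
    ≡⟨ cong₂ _+_ (cong (λ b → indicator b + r) (irrefl G zero)) (∑-distrib-+ _ S) ⟩
  r + (∑[ u < n ] indicator (adj G (suc u) zero) + ∑[ u < n ] S u)
    ≡⟨ cong (λ s → r + (s + ∑[ u < n ] S u)) (sum-cong-≗ (λ u → cong indicator (sym G (suc u) zero))) ⟩
  r + (r + ∑[ u < n ] S u)
    ≡⟨ cong (λ s → r + (r + s)) restricted≡e+e ⟩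
  r + (r + (e + e))
    ≡⟨ rearrange r e ⟩
  (r + e) + (r + e)  ∎)
  where
  open ≡-Reasoning
  r : ℕ
  r = ∑[ v < n ] indicator (adj G zero (suc v))
  S : Fin n → ℕ
  S u = ∑[ v < n ] indicator (adj G (suc u) (suc v))
  rearrange : ∀ r e → r + (r + (e + e)) ≡ (r + e) + (r + e)
  rearrange = solve-∀

sum-degrees-even : (G : Graph n) → ∃[ e ] ∑[ v < n ] degree G v ≡ e + e
sum-degrees-even G with e , eq ← handshake G = e , ≡-trans (sum-cong-≗ (degree≡∑ G)) eq

∑-indicator-≟ : (v : Fin n) → ∑[ w < n ] indicator (does (v ≟ w)) ≡ 1
∑-indicator-≟ {suc n} zero = cong suc (≡-trans (∑-const n 0) (ℕ.*-zeroʳ n))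
∑-indicator-≟ {suc n} (suc v) = ∑-indicator-≟ v

degree-complement : (G : Graph n) (v : Fin n) → suc (degree G v + degree (complement G) v) ≡ n
degree-complement {n} G v = begin
  suc (degree G v + degree Ḡ v)                           ≡⟨ ℕ.+-comm 1 _ ⟩
  degree G v + degree Ḡ v + 1
    ≡⟨ cong₂ _+_ (cong₂ _+_ (degree≡∑ G v) (degree≡∑ Ḡ v)) (≡-sym (∑-indicator-≟ v)) ⟩
  ∑[ w < n ] ι G w + ∑[ w < n ] ι Ḡ w + ∑[ w < n ] ι≟ w
    ≡⟨ ≡-trans (∑-distrib-+ _ ι≟) (cong (_+ ∑[ w < n ] ι≟ w) (∑-distrib-+ (ι G) (ι Ḡ))) ⟨
  ∑[ w < n ] (ι G w + ι Ḡ w + ι≟ w)                       ≡⟨ sum-cong-≗ exactly-one ⟩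
  ∑[ w < n ] 1                                            ≡⟨ ∑-1 n ⟩
  n                                                       ∎
  where
  open ≡-Reasoning
  Ḡ : Graph n
  Ḡ = complement G
  ι : Graph n → Fin n → ℕ
  ι H w = indicator (adj H v w)
  ι≟ : Fin n → ℕ
  ι≟ w = indicator (does (v ≟ w))
  exactly-one : ∀ w → ι G w + ι Ḡ w + ι≟ w ≡ 1
  exactly-one w with v ≟ w
  ... | yes refl rewrite irrefl G v = refl
  ... | no _ with adj G v w
  ...   | true = refl
  ...   | false = refl

sum-degrees-complement : (G : Graph n) →
  n + (∑[ v < n ] degree G v + ∑[ v < n ] degree (complement G) v) ≡ n * n
sum-degrees-complement {n} G = begin
  n + (∑[ v < n ] degree G v + ∑[ v < n ] degree (complement G) v)
    ≡⟨ cong₂ _+_ (∑-1 n) (∑-distrib-+ (degree G) (degree (complement G))) ⟨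
  ∑[ v < n ] 1 + ∑[ v < n ] (degree G v + degree (complement G) v)
    ≡⟨ ∑-distrib-+ (λ _ → 1) (λ v → degree G v + degree (complement G) v) ⟨
  ∑[ v < n ] suc (degree G v + degree (complement G) v)
    ≡⟨ sum-cong-≗ (degree-complement G) ⟩
  ∑[ v < n ] n
    ≡⟨ ∑-const n n ⟩
  n * n  ∎
  where open ≡-Reasoning

idempotent-mod-4 : ∀ r → r < 4 → r ≡ (r * r) % 4 → r ≡ 0 ⊎ r ≡ 1
idempotent-mod-4 0 _ _ = inj₁ refl
idempotent-mod-4 1 _ _ = inj₂ refl
idempotent-mod-4 2 _ ()
idempotent-mod-4 3 _ ()
idempotent-mod-4 (suc (suc (suc (suc _)))) (s≤s (s≤s (s≤s (s≤s ())))) _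

square-mod-4 : ∀ n e → n + e * 4 ≡ n * n → n % 4 ≡ 0 ⊎ n % 4 ≡ 1
square-mod-4 n e eq = idempotent-mod-4 (n % 4) (m%n<n n 4) (begin
  n % 4                  ≡⟨ [m+kn]%n≡m%n n e 4 ⟨
  (n + e * 4) % 4        ≡⟨ cong (_% 4) eq ⟩
  (n * n) % 4            ≡⟨ %-distribˡ-* n n 4 ⟩
  (n % 4 * (n % 4)) % 4  ∎)
  where open ≡-Reasoning

module _ (G : Graph n) (dvo : DuallyVertexOblique G) where

  private
    Ḡ : Graph n
    Ḡ = complement G
    match : Fin n → Fin n
    match u = proj₁ (proj₁ (proj₂ dvo) u)
    match-type : ∀ u → vertexType G u ≡ vertexType Ḡ (match u)
    match-type u = proj₂ (proj₁ (proj₂ dvo) u)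

    match-injective : Injective _≡_ _≡_ match
    match-injective {u} {v} mu≡mv with u ≟ v
    ... | yes u≡v = u≡v
    ... | no u≢v = ⊥-elim (proj₁ dvo u v u≢v
      (≡-trans (match-type u) (≡-trans (cong (vertexType Ḡ) mu≡mv) (≡-sym (match-type v)))))

  degrees-↭-complement : map (degree G) (allFin n) ↭ map (degree Ḡ) (allFin n)
  degrees-↭-complement = begin
    map (degree G) (allFin n)              ≡⟨ map-cong (λ u → vertexType-≡⇒degree-≡ G Ḡ (match-type u)) (allFin n) ⟩
    map (degree Ḡ ∘ match) (allFin n)      ≡⟨ map-∘ (allFin n) ⟩
    map (degree Ḡ) (map match (allFin n))  ↭⟨ map⁺ (degree Ḡ) (map-allFin-↭ match match-injective) ⟩
    map (degree Ḡ) (allFin n)              ∎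
    where open PermutationReasoning

  dvo⇒mod-4 : n % 4 ≡ 0 ⊎ n % 4 ≡ 1
  dvo⇒mod-4 with e , S≡e+e ← sum-degrees-even G = square-mod-4 n e (begin
    n + e * 4                                              ≡⟨ cong (n +_) (quadruple e) ⟩
    n + ((e + e) + (e + e))                                ≡⟨ cong (λ s → n + (s + s)) S≡e+e ⟨
    n + (∑[ v < n ] degree G v + ∑[ v < n ] degree G v)    ≡⟨ cong (λ s → n + (∑[ v < n ] degree G v + s)) S≡S̄ ⟩
    n + (∑[ v < n ] degree G v + ∑[ v < n ] degree Ḡ v)    ≡⟨ sum-degrees-complement G ⟩
    n * n                                                  ∎)
    where
    open ≡-Reasoning
    quadruple : ∀ e → e * 4 ≡ (e + e) + (e + e)
    quadruple = solve-∀
    S≡S̄ : ∑[ v < n ] degree G v ≡ ∑[ v < n ] degree Ḡ v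
    S≡S̄ = ≡-trans (≡-sym (sum-map-allFin (degree G)))
      (≡-trans (sum-↭ degrees-↭-complement) (sum-map-allFin (degree Ḡ)))

-- Exhaustive search

vertexOblique? : (G : Graph n) → Dec (VertexOblique G)
vertexOblique? G = all? λ u → all? λ v →
  ¬? (u ≟ v) →-dec ¬? (≡-dec ℕ._≟_ (vertexType G u) (vertexType G v))

duallyVertexOblique? : (G : Graph n) → Dec (DuallyVertexOblique G)
duallyVertexOblique? G = vertexOblique? G
  ×-dec (all? λ u → any? λ w → ≡-dec ℕ._≟_ (vertexType G u) (vertexType (complement G) w))
  ×-dec (all? λ w → any? λ u → ≡-dec ℕ._≟_ (vertexType (complement G) w) (vertexType G u))

cons : (Fin n → Bool) → Graph n → Graph (suc n)
cons {n} r G = record { adj = a ; sym = a-sym ; irrefl = a-irrefl }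
  where
  a : Fin (suc n) → Fin (suc n) → Bool
  a zero zero = false
  a zero (suc v) = r v
  a (suc u) zero = r u
  a (suc u) (suc v) = adj G u v
  a-sym : ∀ u v → a u v ≡ a v u
  a-sym zero zero = refl
  a-sym zero (suc v) = refl
  a-sym (suc u) zero = refl
  a-sym (suc u) (suc v) = sym G u v
  a-irrefl : ∀ v → a v v ≡ false
  a-irrefl zero = refl
  a-irrefl (suc v) = irrefl G v

cons-cong : {r s : Fin n → Bool} {G H : Graph n} → r ≗ s → G ≈ᴳ H → cons r G ≈ᴳ cons s H
cons-cong r≗s G≈H = same-adj λ where
  zero zero → refl
  zero (suc v) → r≗s v
  (suc u) zero → r≗s u
  (suc u) (suc v) → adj-≡ G≈H u v

cons-restrict : (G : Graph (suc n)) → cons (adj G zero ∘ suc) (restrict G) ≈ᴳ G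
cons-restrict G = same-adj λ where
  zero zero → ≡-sym (irrefl G zero)
  zero (suc v) → refl
  (suc u) zero → sym G zero (suc u)
  (suc u) (suc v) → refl

∀-vec? : ∀ k {P : Vec Bool k → Set} → (∀ bs → Dec (P bs)) → Dec (∀ bs → P bs)
∀-vec? zero P? = map′ (λ { p [] → p }) (λ all → all []) (P? [])
∀-vec? (suc k) P? = map′
  (λ { (p , q) (true ∷ bs) → p bs ; (p , q) (false ∷ bs) → q bs })
  (λ all → (λ bs → all (true ∷ bs)) , (λ bs → all (false ∷ bs)))
  (∀-vec? k (λ bs → P? (true ∷ bs)) ×-dec ∀-vec? k (λ bs → P? (false ∷ bs)))

AdjInvariant : (Graph n → Set) → Set
AdjInvariant P = ∀ {G H} → G ≈ᴳ H → P G → P H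

∀-graph? : {P : Graph n → Set} → AdjInvariant P → (∀ G → Dec (P G)) → Dec (∀ G → P G)
∀-graph? {zero} inv P? = map′ (λ p G → inv (same-adj λ ()) p) (λ all → all edgeless) (P? edgeless)
  where
  edgeless : Graph 0
  edgeless = record { adj = λ () ; sym = λ () ; irrefl = λ () }
∀-graph? {suc n} {P} inv P? = map′ extend restrict-all
  (∀-graph? (λ {G} {H} G≈H p bs → inv (cons-cong {r = lookup bs} (λ _ → refl) G≈H) (p bs))
            (λ H → ∀-vec? n (λ bs → P? (cons (lookup bs) H))))
  where
  extend : (∀ H (bs : Vec Bool n) → P (cons (lookup bs) H)) → ∀ G → P G
  extend all G = inv (≈ᴳ-trans (cons-cong (lookup∘tabulate (adj G zero ∘ suc)) (≈ᴳ-refl (restrict G))) (cons-restrict G))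
    (all (restrict G) (Vec.tabulate (adj G zero ∘ suc)))
  restrict-all : (∀ G → P G) → ∀ H (bs : Vec Bool n) → P (cons (lookup bs) H)
  restrict-all all H bs = all (cons (lookup bs) H)

¬vertexOblique-invariant : AdjInvariant {n} (λ G → ¬ VertexOblique G)
¬vertexOblique-invariant G≈H ¬voG voH = ¬voG (vertexOblique-cong (≈ᴳ-sym G≈H) voH)

no-vertexOblique : (n ≡ 4 ⊎ n ≡ 5) → (G : Graph n) → ¬ VertexOblique G
no-vertexOblique (inj₁ refl) = from-yes (∀-graph? {4} ¬vertexOblique-invariant (¬? ∘ vertexOblique?))
no-vertexOblique (inj₂ refl) = from-yes (∀-graph? {5} ¬vertexOblique-invariant (¬? ∘ vertexOblique?))

-- Gluing a gadget onto a graph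

data Side (k n : ℕ) : Fin (k + n) → Set where
  left : (y : Fin k) → Side k n (y ↑ˡ n)
  right : (i : Fin n) → Side k n (k ↑ʳ i)

side : ∀ k n (u : Fin (k + n)) → Side k n u
side k n u = subst (Side k n) (join-splitAt k n u) (from-sum (splitAt k u))
  where
  from-sum : (s : Fin k ⊎ Fin n) → Side k n (join k n s)
  from-sum (inj₁ y) = left y
  from-sum (inj₂ i) = right i

does-↑ˡ-≟ : ∀ (x y : Fin k) n → does (x ↑ˡ n ≟ y ↑ˡ n) ≡ does (x ≟ y)
does-↑ˡ-≟ x y n = does-⇔ (mk⇔ (↑ˡ-injective n x y) (cong (_↑ˡ n))) (x ↑ˡ n ≟ y ↑ˡ n) (x ≟ y)

does-↑ʳ-≟ : ∀ k (i j : Fin n) → does (k ↑ʳ i ≟ k ↑ʳ j) ≡ does (i ≟ j)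
does-↑ʳ-≟ k i j = does-⇔ (mk⇔ (↑ʳ-injective k i j) (cong (k ↑ʳ_))) (k ↑ʳ i ≟ k ↑ʳ j) (i ≟ j)

↑ˡ≢↑ʳ : ∀ (x : Fin k) (j : Fin n) → ¬ x ↑ˡ n ≡ k ↑ʳ j
↑ˡ≢↑ʳ {k} {n} x j eq with () ← ≡-trans (≡-sym (splitAt-↑ˡ k x n)) (≡-trans (cong (splitAt k) eq) (splitAt-↑ʳ k n j))

members : (Fin k → Bool) → List (Fin k)
members {k} J = filterᵇ J (allFin k)

weigh : ℕ → Bool × ℕ → ℕ
weigh n (b , d) = d + (if b then n else 0)

profile : Graph k → (Fin k → Bool) → Fin k → Bool × ℕ
profile F J y = J y , degree F y

module Glue (F : Graph k) (J : Fin k → Bool) where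

  glueAdj : Graph n → Fin k ⊎ Fin n → Fin k ⊎ Fin n → Bool
  glueAdj G (inj₁ x) (inj₁ y) = adj F x y
  glueAdj G (inj₁ x) (inj₂ j) = J x
  glueAdj G (inj₂ i) (inj₁ y) = J y
  glueAdj G (inj₂ i) (inj₂ j) = adj G i j

  glueAdj-sym : (G : Graph n) → ∀ s t → glueAdj G s t ≡ glueAdj G t s
  glueAdj-sym G (inj₁ x) (inj₁ y) = sym F x y
  glueAdj-sym G (inj₁ x) (inj₂ j) = refl
  glueAdj-sym G (inj₂ i) (inj₁ y) = refl
  glueAdj-sym G (inj₂ i) (inj₂ j) = sym G i j

  glueAdj-irrefl : (G : Graph n) → ∀ s → glueAdj G s s ≡ false
  glueAdj-irrefl G (inj₁ x) = irrefl F x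
  glueAdj-irrefl G (inj₂ i) = irrefl G i

  glue : Graph n → Graph (k + n)
  glue G = record
    { adj = λ u v → glueAdj G (splitAt k u) (splitAt k v)
    ; sym = λ u v → glueAdj-sym G (splitAt k u) (splitAt k v)
    ; irrefl = λ v → glueAdj-irrefl G (splitAt k v)
    }

  c : ℕ
  c = length (members J)

  module _ {n} (G : Graph n) where

    newWeight : Fin k → ℕ
    newWeight = weigh n ∘ profile F J

    oldWeight : Fin n → ℕ
    oldWeight i = c + degree G i

    neighbours-glue : ∀ u → neighbours (glue G) u ≡
      map (_↑ˡ n) (filterᵇ (glueAdj G (splitAt k u) ∘ inj₁) (allFin k))
        ++ map (k ↑ʳ_) (filterᵇ (glueAdj G (splitAt k u) ∘ inj₂) (allFin n))
    neighbours-glue u = begin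
      filterᵇ p (allFin (k + n))
        ≡⟨ cong (filterᵇ p) (allFin-+ k n) ⟩
      filterᵇ p (map (_↑ˡ n) (allFin k) ++ map (k ↑ʳ_) (allFin n))
        ≡⟨ filter-++ (T? ∘ p) (map (_↑ˡ n) (allFin k)) _ ⟩
      filterᵇ p (map (_↑ˡ n) (allFin k)) ++ filterᵇ p (map (k ↑ʳ_) (allFin n))
        ≡⟨ cong₂ _++_ (filterᵇ-map p (_↑ˡ n) (allFin k)) (filterᵇ-map p (k ↑ʳ_) (allFin n)) ⟩
      map (_↑ˡ n) (filterᵇ (p ∘ (_↑ˡ n)) (allFin k)) ++ map (k ↑ʳ_) (filterᵇ (p ∘ (k ↑ʳ_)) (allFin n))
        ≡⟨ cong₂ (λ xs ys → map (_↑ˡ n) xs ++ map (k ↑ʳ_) ys)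
             (filterᵇ-cong (λ y → cong (glueAdj G (splitAt k u)) (splitAt-↑ˡ k y n)) (allFin k))
             (filterᵇ-cong (λ j → cong (glueAdj G (splitAt k u)) (splitAt-↑ʳ k n j)) (allFin n)) ⟩
      map (_↑ˡ n) (filterᵇ (glueAdj G (splitAt k u) ∘ inj₁) (allFin k))
        ++ map (k ↑ʳ_) (filterᵇ (glueAdj G (splitAt k u) ∘ inj₂) (allFin n))  ∎
      where
      open ≡-Reasoning
      p : Fin (k + n) → Bool
      p = adj (glue G) u

    neighbours-glue-new : ∀ y → neighbours (glue G) (y ↑ˡ n) ≡
      map (_↑ˡ n) (neighbours F y) ++ map (k ↑ʳ_) (if J y then allFin n else [])
    neighbours-glue-new y rewrite neighbours-glue (y ↑ˡ n) | splitAt-↑ˡ k y n =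
      cong (λ js → map (_↑ˡ n) (neighbours F y) ++ map (k ↑ʳ_) js) (filterᵇ-const (J y) (allFin n))

    neighbours-glue-old : ∀ i → neighbours (glue G) (k ↑ʳ i) ≡
      map (_↑ˡ n) (members J) ++ map (k ↑ʳ_) (neighbours G i)
    neighbours-glue-old i rewrite neighbours-glue (k ↑ʳ i) | splitAt-↑ʳ k n i = refl

    degree-glue-new : ∀ y → degree (glue G) (y ↑ˡ n) ≡ newWeight y
    degree-glue-new y = begin
      length (neighbours (glue G) (y ↑ˡ n))
        ≡⟨ cong length (neighbours-glue-new y) ⟩
      length (map (_↑ˡ n) (neighbours F y) ++ map (k ↑ʳ_) (if J y then allFin n else []))
        ≡⟨ length-++ (map (_↑ˡ n) (neighbours F y)) ⟩
      length (map (_↑ˡ n) (neighbours F y)) + length (map (k ↑ʳ_) (if J y then allFin n else []))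
        ≡⟨ cong₂ _+_ (length-map (_↑ˡ n) (neighbours F y)) (length-map (k ↑ʳ_) (if J y then allFin n else [])) ⟩
      degree F y + length (if J y then allFin n else [])
        ≡⟨ cong (degree F y +_) (≡-trans (length-if (J y) (allFin n)) (cong (if J y then_else 0) (length-tabulate id))) ⟩
      newWeight y  ∎
      where open ≡-Reasoning

    degree-glue-old : ∀ i → degree (glue G) (k ↑ʳ i) ≡ oldWeight i
    degree-glue-old i = begin
      length (neighbours (glue G) (k ↑ʳ i))
        ≡⟨ cong length (neighbours-glue-old i) ⟩
      length (map (_↑ˡ n) (members J) ++ map (k ↑ʳ_) (neighbours G i))
        ≡⟨ length-++ (map (_↑ˡ n) (members J)) ⟩
      length (map (_↑ˡ n) (members J)) + length (map (k ↑ʳ_) (neighbours G i))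
        ≡⟨ cong₂ _+_ (length-map (_↑ˡ n) (members J)) (length-map (k ↑ʳ_) (neighbours G i)) ⟩
      oldWeight i  ∎
      where open ≡-Reasoning

    map-degree-glue : ∀ xs ys → map (degree (glue G)) (map (_↑ˡ n) xs ++ map (k ↑ʳ_) ys)
      ≡ map newWeight xs ++ map oldWeight ys
    map-degree-glue xs ys = ≡-trans (map-++ (degree (glue G)) (map (_↑ˡ n) xs) _) (cong₂ _++_
      (≡-trans (≡-sym (map-∘ xs)) (map-cong degree-glue-new xs))
      (≡-trans (≡-sym (map-∘ ys)) (map-cong degree-glue-old ys)))

    vertexType-glue-new : ∀ y → vertexType (glue G) (y ↑ˡ n) ≡
      sortDesc (map newWeight (neighbours F y) ++ map oldWeight (if J y then allFin n else []))
    vertexType-glue-new y = cong sortDesc (≡-trans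
      (cong (map (degree (glue G))) (neighbours-glue-new y))
      (map-degree-glue (neighbours F y) (if J y then allFin n else [])))

    vertexType-glue-old : ∀ i → vertexType (glue G) (k ↑ʳ i) ≡
      sortDesc (map newWeight (members J) ++ map oldWeight (neighbours G i))
    vertexType-glue-old i = cong sortDesc (≡-trans
      (cong (map (degree (glue G))) (neighbours-glue-old i))
      (map-degree-glue (members J) (neighbours G i)))

complement-glue : (F : Graph k) (J : Fin k → Bool) (G : Graph n) →
  complement (Glue.glue F J G) ≈ᴳ Glue.glue (complement F) (not ∘ J) (complement G)
complement-glue {k} {n} F J G = same-adj λ u v → on-sides (side k n u) (side k n v)
  where
  on-sides : ∀ {u v} → Side k n u → Side k n v →
    adj (complement (Glue.glue F J G)) u v ≡ adj (Glue.glue (complement F) (not ∘ J) (complement G)) u v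
  on-sides (left x) (left y)
    rewrite splitAt-↑ˡ k x n | splitAt-↑ˡ k y n | does-↑ˡ-≟ x y n = refl
  on-sides (left x) (right j)
    rewrite splitAt-↑ˡ k x n | splitAt-↑ʳ k n j | dec-false (x ↑ˡ n ≟ k ↑ʳ j) (↑ˡ≢↑ʳ x j) = refl
  on-sides (right i) (left y)
    rewrite splitAt-↑ʳ k n i | splitAt-↑ˡ k y n | dec-false (k ↑ʳ i ≟ y ↑ˡ n) (↑ˡ≢↑ʳ y i ∘ ≡-sym) = refl
  on-sides (right i) (right j)
    rewrite splitAt-↑ʳ k n i | splitAt-↑ʳ k n j | does-↑ʳ-≟ k i j = refl

record Gadget (k : ℕ) : Set where
  field
    F : Graph k
    J : Fin k → Bool
    member-degree : ∀ y → J y ≡ true → length (members J) ≤ degree F y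
    nonmember-degree : ∀ y → J y ≡ false → degree F y < length (members J)
    signature-injective : ∀ y y′ → J y ≡ J y′ → degree F y ≡ degree F y′ →
      length (filterᵇ J (neighbours F y)) ≡ length (filterᵇ J (neighbours F y′)) → y ≡ y′
    π : Fin k → Fin k
    π-injective : Injective _≡_ _≡_ π
    π-flips : ∀ y → not (J (π y)) ≡ J y
    π-profile : ∀ y → map (profile (complement F) (not ∘ J)) (neighbours (complement F) (π y))
                      ↭ map (profile F J) (neighbours F y)
    members-profile : map (profile (complement F) (not ∘ J)) (members (not ∘ J))
                      ↭ map (profile F J) (members J)

module _ (𝒢 : Gadget k) {n} (G : Graph n) where

  open Gadget 𝒢
  open Glue F J

  private
    big : ℕ → Bool
    big w = does (c ℕ.≤? w)

    big-newWeight : ∀ z → big (newWeight G z) ≡ J z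
    big-newWeight z with J z in Jz≡b
    ... | true = dec-true (c ℕ.≤? _) (ℕ.≤-trans (member-degree z Jz≡b) (ℕ.m≤m+n _ n))
    ... | false = dec-false (c ℕ.≤? _) (ℕ.<⇒≱ (subst (_< c) (≡-sym (ℕ.+-identityʳ _)) (nonmember-degree z Jz≡b)))

    count-big : ∀ xs → length (filterᵇ big (map (newWeight G) xs)) ≡ length (filterᵇ J xs)
    count-big xs = ≡-trans (cong length (≡-trans (filterᵇ-map big (newWeight G) xs)
        (cong (map (newWeight G)) (filterᵇ-cong big-newWeight xs))))
      (length-map (newWeight G) (filterᵇ J xs))

    newWeight≢oldWeight : ∀ y i → ¬ newWeight G y ≡ oldWeight G i
    newWeight≢oldWeight y i eq with J y in Jy≡b
    ... | true = ℕ.<-irrefl (≡-sym eq)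
      (ℕ.<-≤-trans (ℕ.+-monoʳ-< c (degree<n G i)) (ℕ.+-monoˡ-≤ n (member-degree y Jy≡b)))
    ... | false = ℕ.<-irrefl eq
      (ℕ.<-≤-trans (subst (_< c) (≡-sym (ℕ.+-identityʳ _)) (nonmember-degree y Jy≡b)) (ℕ.m≤m+n c _))

    new≢old : ∀ y i → ¬ vertexType (glue G) (y ↑ˡ n) ≡ vertexType (glue G) (k ↑ʳ i)
    new≢old y i eq = newWeight≢oldWeight y i (≡-trans (≡-sym (degree-glue-new G y))
      (≡-trans (vertexType-≡⇒degree-≡ (glue G) (glue G) eq) (degree-glue-old G i)))

    new-injective : ∀ y y′ → vertexType (glue G) (y ↑ˡ n) ≡ vertexType (glue G) (y′ ↑ˡ n) → y ≡ y′
    new-injective y y′ eq = signature-injective y y′ J-eq degree-eq count-eq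
      where
      weight-eq : newWeight G y ≡ newWeight G y′
      weight-eq = ≡-trans (≡-sym (degree-glue-new G y))
        (≡-trans (vertexType-≡⇒degree-≡ (glue G) (glue G) eq) (degree-glue-new G y′))
      J-eq : J y ≡ J y′
      J-eq = ≡-trans (≡-sym (big-newWeight y)) (≡-trans (cong big weight-eq) (big-newWeight y′))
      types-↭ : map (newWeight G) (neighbours F y) ++ map (oldWeight G) (if J y then allFin n else [])
              ↭ map (newWeight G) (neighbours F y′) ++ map (oldWeight G) (if J y′ then allFin n else [])
      types-↭ = sortDesc-≡⇒↭ (≡-trans (≡-sym (vertexType-glue-new G y)) (≡-trans eq (vertexType-glue-new G y′)))
      weights-↭ : map (newWeight G) (neighbours F y) ↭ map (newWeight G) (neighbours F y′)
      weights-↭ = ++-cancelʳ-↭ (map (oldWeight G) (if J y then allFin n else []))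
        (subst (λ b → map (newWeight G) (neighbours F y) ++ map (oldWeight G) (if J y then allFin n else [])
                    ↭ map (newWeight G) (neighbours F y′) ++ map (oldWeight G) (if b then allFin n else []))
          (≡-sym J-eq) types-↭)
      degree-eq : degree F y ≡ degree F y′
      degree-eq = ≡-trans (≡-sym (length-map (newWeight G) (neighbours F y)))
        (≡-trans (↭-length weights-↭) (length-map (newWeight G) (neighbours F y′)))
      count-eq : length (filterᵇ J (neighbours F y)) ≡ length (filterᵇ J (neighbours F y′))
      count-eq = ≡-trans (≡-sym (count-big (neighbours F y)))
        (≡-trans (↭-length (filter-↭ (T? ∘ big) weights-↭)) (count-big (neighbours F y′)))

    old-reflects-type : ∀ i j → vertexType (glue G) (k ↑ʳ i) ≡ vertexType (glue G) (k ↑ʳ j) →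
      vertexType G i ≡ vertexType G j
    old-reflects-type i j eq = ↭⇒sortDesc-≡ (map-+-cancel-↭ c (begin
      map (c +_) (map (degree G) (neighbours G i))  ≡⟨ map-∘ (neighbours G i) ⟨
      map (oldWeight G) (neighbours G i)            ↭⟨ ++-cancelˡ-↭ (map (newWeight G) (members J)) types-↭ ⟩
      map (oldWeight G) (neighbours G j)            ≡⟨ map-∘ (neighbours G j) ⟩
      map (c +_) (map (degree G) (neighbours G j))  ∎))
      where
      open PermutationReasoning
      types-↭ : map (newWeight G) (members J) ++ map (oldWeight G) (neighbours G i)
              ↭ map (newWeight G) (members J) ++ map (oldWeight G) (neighbours G j)
      types-↭ = sortDesc-≡⇒↭ (≡-trans (≡-sym (vertexType-glue-old G i)) (≡-trans eq (vertexType-glue-old G j)))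

  glue-vertexOblique : VertexOblique G → VertexOblique (glue G)
  glue-vertexOblique voG u v = on-sides (side k n u) (side k n v)
    where
    on-sides : ∀ {u v} → Side k n u → Side k n v → ¬ u ≡ v → ¬ vertexType (glue G) u ≡ vertexType (glue G) v
    on-sides (left y) (left y′) u≢v eq = u≢v (cong (_↑ˡ n) (new-injective y y′ eq))
    on-sides (left y) (right i) _ eq = new≢old y i eq
    on-sides (right i) (left y) _ eq = new≢old y i (≡-sym eq)
    on-sides (right i) (right j) u≢v eq = voG i j (u≢v ∘ cong (k ↑ʳ_)) (old-reflects-type i j eq)

  private
    module Glueᶜ = Glue (complement F) (not ∘ J)

    members-count : Glueᶜ.c ≡ c
    members-count = ≡-trans (≡-sym (length-map (profile (complement F) (not ∘ J)) (members (not ∘ J))))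
      (≡-trans (↭-length members-profile) (length-map (profile F J) (members J)))

    newWeights-complement : {xs ys : List (Fin k)} →
      map (profile (complement F) (not ∘ J)) xs ↭ map (profile F J) ys →
      map (Glueᶜ.newWeight (complement G)) xs ↭ map (newWeight G) ys
    newWeights-complement {xs} {ys} profiles-↭ = begin
      map (Glueᶜ.newWeight (complement G)) xs             ≡⟨ map-∘ xs ⟩
      map (weigh n) (map (profile (complement F) (not ∘ J)) xs) ↭⟨ map⁺ (weigh n) profiles-↭ ⟩
      map (weigh n) (map (profile F J) ys)                ≡⟨ map-∘ ys ⟨
      map (newWeight G) ys                                ∎
      where open PermutationReasoning

    oldWeights-complement : {xs ys : List (Fin n)} →
      map (degree G) xs ↭ map (degree (complement G)) ys →
      map (oldWeight G) xs ↭ map (Glueᶜ.oldWeight (complement G)) ys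
    oldWeights-complement {xs} {ys} degrees-↭ = begin
      map (oldWeight G) xs                                  ≡⟨ map-∘ xs ⟩
      map (c +_) (map (degree G) xs)                        ↭⟨ map⁺ (c +_) degrees-↭ ⟩
      map (c +_) (map (degree (complement G)) ys)           ≡⟨ cong (λ m → map (m +_) (map (degree (complement G)) ys)) members-count ⟨
      map (Glueᶜ.c +_) (map (degree (complement G)) ys)     ≡⟨ map-∘ ys ⟨
      map (Glueᶜ.oldWeight (complement G)) ys               ∎
      where open PermutationReasoning

    old-match : ∀ i j → vertexType G i ≡ vertexType (complement G) j →
      vertexType (glue G) (k ↑ʳ i) ≡ vertexType (complement (glue G)) (k ↑ʳ j)
    old-match i j eq = begin
      vertexType (glue G) (k ↑ʳ i)
        ≡⟨ vertexType-glue-old G i ⟩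
      sortDesc (map (newWeight G) (members J) ++ map (oldWeight G) (neighbours G i))
        ≡⟨ ↭⇒sortDesc-≡ (++⁺ (↭-sym (newWeights-complement members-profile))
                              (oldWeights-complement (sortDesc-≡⇒↭ eq))) ⟩
      sortDesc (map (Glueᶜ.newWeight (complement G)) (members (not ∘ J))
                ++ map (Glueᶜ.oldWeight (complement G)) (neighbours (complement G) j))
        ≡⟨ Glueᶜ.vertexType-glue-old (complement G) j ⟨
      vertexType (Glueᶜ.glue (complement G)) (k ↑ʳ j)
        ≡⟨ vertexType-cong (complement-glue F J G) (k ↑ʳ j) ⟨
      vertexType (complement (glue G)) (k ↑ʳ j)  ∎
      where open ≡-Reasoning

    new-match : DuallyVertexOblique G → ∀ y →
      vertexType (glue G) (y ↑ˡ n) ≡ vertexType (complement (glue G)) (π y ↑ˡ n)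
    new-match dvo y = begin
      vertexType (glue G) (y ↑ˡ n)
        ≡⟨ vertexType-glue-new G y ⟩
      sortDesc (map (newWeight G) (neighbours F y) ++ map (oldWeight G) (if J y then allFin n else []))
        ≡⟨ ↭⇒sortDesc-≡ (++⁺ (↭-sym (newWeights-complement (π-profile y))) (joined-↭ (J y))) ⟩
      sortDesc (map (Glueᶜ.newWeight (complement G)) (neighbours (complement F) (π y))
                ++ map (Glueᶜ.oldWeight (complement G)) (if J y then allFin n else []))
        ≡⟨ cong (λ b → sortDesc (map (Glueᶜ.newWeight (complement G)) (neighbours (complement F) (π y))
                  ++ map (Glueᶜ.oldWeight (complement G)) (if b then allFin n else []))) (π-flips y) ⟨
      sortDesc (map (Glueᶜ.newWeight (complement G)) (neighbours (complement F) (π y))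
                ++ map (Glueᶜ.oldWeight (complement G)) (if not (J (π y)) then allFin n else []))
        ≡⟨ Glueᶜ.vertexType-glue-new (complement G) (π y) ⟨
      vertexType (Glueᶜ.glue (complement G)) (π y ↑ˡ n)
        ≡⟨ vertexType-cong (complement-glue F J G) (π y ↑ˡ n) ⟨
      vertexType (complement (glue G)) (π y ↑ˡ n)  ∎
      where
      open ≡-Reasoning
      joined-↭ : ∀ b → map (oldWeight G) (if b then allFin n else [])
                       ↭ map (Glueᶜ.oldWeight (complement G)) (if b then allFin n else [])
      joined-↭ true = oldWeights-complement (degrees-↭-complement G dvo)
      joined-↭ false = ↭-refl

  glue-duallyVertexOblique : DuallyVertexOblique G → DuallyVertexOblique (glue G)
  glue-duallyVertexOblique dvo@(voG , G→Ḡ , Ḡ→G) =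
    glue-vertexOblique voG , (λ u → forward (side k n u)) , (λ w → backward (side k n w))
    where
    forward : ∀ {u} → Side k n u → ∃[ w ] vertexType (glue G) u ≡ vertexType (complement (glue G)) w
    forward (left y) = π y ↑ˡ n , new-match dvo y
    forward (right i) with j , eq ← G→Ḡ i = k ↑ʳ j , old-match i j eq
    backward : ∀ {w} → Side k n w → ∃[ u ] vertexType (complement (glue G)) w ≡ vertexType (glue G) u
    backward (left y′) with y , refl ← injective⇒surjective π π-injective y′ = y ↑ˡ n , ≡-sym (new-match dvo y)
    backward (right j) with i , eq ← Ḡ→G j = k ↑ʳ i , ≡-sym (old-match i j (≡-sym eq))

-- The gadget and the base graphs

Matrix : ℕ → Set
Matrix n = Vec (Vec Bool n) n

entry : Matrix n → Fin n → Fin n → Bool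
entry M u v = lookup (lookup M u) v

fromMatrix : (M : Matrix n) →
  True (all? λ u → all? λ v → entry M u v Bool.≟ entry M v u) →
  True (all? λ v → entry M v v Bool.≟ false) → Graph n
fromMatrix M symmetric irreflexive = record
  { adj = entry M ; sym = toWitness symmetric ; irrefl = toWitness irreflexive }

private
  ○ ● : Bool
  ○ = false
  ● = true

F₈ : Graph 8
F₈ = fromMatrix
  ( (○ ∷ ● ∷ ○ ∷ ● ∷ ● ∷ ○ ∷ ○ ∷ ● ∷ []) ∷
    (● ∷ ○ ∷ ● ∷ ● ∷ ○ ∷ ○ ∷ ● ∷ ○ ∷ []) ∷
    (○ ∷ ● ∷ ○ ∷ ● ∷ ● ∷ ○ ∷ ● ∷ ● ∷ []) ∷
    (● ∷ ● ∷ ● ∷ ○ ∷ ○ ∷ ● ∷ ○ ∷ ● ∷ []) ∷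
    (● ∷ ○ ∷ ● ∷ ○ ∷ ○ ∷ ○ ∷ ○ ∷ ○ ∷ []) ∷
    (○ ∷ ○ ∷ ○ ∷ ● ∷ ○ ∷ ○ ∷ ● ∷ ○ ∷ []) ∷
    (○ ∷ ● ∷ ● ∷ ○ ∷ ○ ∷ ● ∷ ○ ∷ ○ ∷ []) ∷
    (● ∷ ○ ∷ ● ∷ ● ∷ ○ ∷ ○ ∷ ○ ∷ ○ ∷ []) ∷
    [] ) _ _

J₈ : Fin 8 → Bool
J₈ y = toℕ y <ᵇ 4

π₈ : Fin 8 → Fin 8
π₈ = lookup (6F ∷ 7F ∷ 5F ∷ 4F ∷ 3F ∷ 2F ∷ 0F ∷ 1F ∷ [])


-- The profile lists compared in π-profile and members-profile are exact reverses of
-- each other, so the permutations are established by deciding an equality.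
gadget₈ : Gadget 8
gadget₈ = record
  { F = F₈
  ; J = J₈
  ; member-degree = from-yes (all? λ y → (J₈ y Bool.≟ true) →-dec (length (members J₈) ℕ.≤? degree F₈ y))
  ; nonmember-degree = from-yes (all? λ y → (J₈ y Bool.≟ false) →-dec (degree F₈ y ℕ.<? length (members J₈)))
  ; signature-injective = from-yes (all? λ y → all? λ y′ → (J₈ y Bool.≟ J₈ y′)
      →-dec (degree F₈ y ℕ.≟ degree F₈ y′)
      →-dec (length (filterᵇ J₈ (neighbours F₈ y)) ℕ.≟ length (filterᵇ J₈ (neighbours F₈ y′)))
      →-dec (y ≟ y′))
  ; π = π₈
  ; π-injective = λ {x} {y} → from-yes (all? λ x → all? λ y → (π₈ x ≟ π₈ y) →-dec (x ≟ y)) x y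
  ; π-flips = from-yes (all? λ y → not (J₈ (π₈ y)) Bool.≟ J₈ y)
  ; π-profile = λ y → ≡-reverse⇒↭ (from-yes (all? λ y →
      ≡-dec (Product.≡-dec Bool._≟_ ℕ._≟_) (map (profile F̄₈ (not ∘ J₈)) (neighbours F̄₈ (π₈ y)))
        (reverse (map (profile F₈ J₈) (neighbours F₈ y)))) y)
  ; members-profile = ≡-reverse⇒↭ (from-yes
      (≡-dec (Product.≡-dec Bool._≟_ ℕ._≟_) (map (profile F̄₈ (not ∘ J₈)) (members (not ∘ J₈)))
        (reverse (map (profile F₈ J₈) (members J₈)))))
  }
  where
  F̄₈ : Graph 8
  F̄₈ = complement F₈

G₈ : Graph 8
G₈ = fromMatrix
  ( (○ ∷ ○ ∷ ● ∷ ● ∷ ○ ∷ ● ∷ ● ∷ ● ∷ []) ∷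
    (○ ∷ ○ ∷ ○ ∷ ○ ∷ ○ ∷ ● ∷ ● ∷ ○ ∷ []) ∷
    (● ∷ ○ ∷ ○ ∷ ○ ∷ ● ∷ ○ ∷ ○ ∷ ○ ∷ []) ∷
    (● ∷ ○ ∷ ○ ∷ ○ ∷ ● ∷ ● ∷ ● ∷ ○ ∷ []) ∷
    (○ ∷ ○ ∷ ● ∷ ● ∷ ○ ∷ ○ ∷ ● ∷ ○ ∷ []) ∷
    (● ∷ ● ∷ ○ ∷ ● ∷ ○ ∷ ○ ∷ ○ ∷ ● ∷ []) ∷
    (● ∷ ● ∷ ○ ∷ ● ∷ ● ∷ ○ ∷ ○ ∷ ● ∷ []) ∷
    (● ∷ ○ ∷ ○ ∷ ○ ∷ ○ ∷ ● ∷ ● ∷ ○ ∷ []) ∷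
    [] ) _ _

G₉ : Graph 9
G₉ = fromMatrix
  ( (○ ∷ ● ∷ ○ ∷ ● ∷ ● ∷ ● ∷ ○ ∷ ○ ∷ ● ∷ []) ∷
    (● ∷ ○ ∷ ● ∷ ○ ∷ ○ ∷ ● ∷ ○ ∷ ● ∷ ● ∷ []) ∷
    (○ ∷ ● ∷ ○ ∷ ● ∷ ○ ∷ ○ ∷ ● ∷ ○ ∷ ○ ∷ []) ∷
    (● ∷ ○ ∷ ● ∷ ○ ∷ ● ∷ ○ ∷ ○ ∷ ● ∷ ○ ∷ []) ∷
    (● ∷ ○ ∷ ○ ∷ ● ∷ ○ ∷ ● ∷ ● ∷ ● ∷ ○ ∷ []) ∷
    (● ∷ ● ∷ ○ ∷ ○ ∷ ● ∷ ○ ∷ ● ∷ ○ ∷ ● ∷ []) ∷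
    (○ ∷ ○ ∷ ● ∷ ○ ∷ ● ∷ ● ∷ ○ ∷ ○ ∷ ○ ∷ []) ∷
    (○ ∷ ● ∷ ○ ∷ ● ∷ ● ∷ ○ ∷ ○ ∷ ○ ∷ ○ ∷ []) ∷
    (● ∷ ● ∷ ○ ∷ ○ ∷ ○ ∷ ● ∷ ○ ∷ ○ ∷ ○ ∷ []) ∷
    [] ) _ _

G₁₂ : Graph 12
G₁₂ = fromMatrix
  ( (○ ∷ ● ∷ ○ ∷ ○ ∷ ○ ∷ ● ∷ ○ ∷ ● ∷ ○ ∷ ○ ∷ ○ ∷ ● ∷ []) ∷
    (● ∷ ○ ∷ ● ∷ ○ ∷ ● ∷ ● ∷ ○ ∷ ● ∷ ● ∷ ○ ∷ ● ∷ ○ ∷ []) ∷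
    (○ ∷ ● ∷ ○ ∷ ○ ∷ ○ ∷ ● ∷ ● ∷ ○ ∷ ● ∷ ● ∷ ○ ∷ ● ∷ []) ∷
    (○ ∷ ○ ∷ ○ ∷ ○ ∷ ● ∷ ○ ∷ ● ∷ ○ ∷ ○ ∷ ● ∷ ● ∷ ○ ∷ []) ∷
    (○ ∷ ● ∷ ○ ∷ ● ∷ ○ ∷ ○ ∷ ● ∷ ● ∷ ○ ∷ ● ∷ ● ∷ ● ∷ []) ∷
    (● ∷ ● ∷ ● ∷ ○ ∷ ○ ∷ ○ ∷ ○ ∷ ○ ∷ ○ ∷ ● ∷ ● ∷ ● ∷ []) ∷
    (○ ∷ ○ ∷ ● ∷ ● ∷ ● ∷ ○ ∷ ○ ∷ ○ ∷ ● ∷ ○ ∷ ○ ∷ ● ∷ []) ∷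
    (● ∷ ● ∷ ○ ∷ ○ ∷ ● ∷ ○ ∷ ○ ∷ ○ ∷ ● ∷ ● ∷ ○ ∷ ○ ∷ []) ∷
    (○ ∷ ● ∷ ● ∷ ○ ∷ ○ ∷ ○ ∷ ● ∷ ● ∷ ○ ∷ ○ ∷ ● ∷ ● ∷ []) ∷
    (○ ∷ ○ ∷ ● ∷ ● ∷ ● ∷ ● ∷ ○ ∷ ● ∷ ○ ∷ ○ ∷ ○ ∷ ○ ∷ []) ∷
    (○ ∷ ● ∷ ○ ∷ ● ∷ ● ∷ ● ∷ ○ ∷ ○ ∷ ● ∷ ○ ∷ ○ ∷ ○ ∷ []) ∷
    (● ∷ ○ ∷ ● ∷ ○ ∷ ● ∷ ● ∷ ● ∷ ○ ∷ ● ∷ ○ ∷ ○ ∷ ○ ∷ []) ∷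
    [] ) _ _

G₁₃ : Graph 13
G₁₃ = fromMatrix
  ( (○ ∷ ○ ∷ ● ∷ ○ ∷ ● ∷ ○ ∷ ● ∷ ● ∷ ○ ∷ ○ ∷ ○ ∷ ● ∷ ○ ∷ []) ∷
    (○ ∷ ○ ∷ ● ∷ ● ∷ ● ∷ ○ ∷ ● ∷ ○ ∷ ● ∷ ○ ∷ ○ ∷ ○ ∷ ● ∷ []) ∷
    (● ∷ ● ∷ ○ ∷ ○ ∷ ● ∷ ● ∷ ● ∷ ○ ∷ ○ ∷ ○ ∷ ● ∷ ○ ∷ ○ ∷ []) ∷
    (○ ∷ ● ∷ ○ ∷ ○ ∷ ○ ∷ ● ∷ ○ ∷ ● ∷ ● ∷ ● ∷ ● ∷ ○ ∷ ● ∷ []) ∷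
    (● ∷ ● ∷ ● ∷ ○ ∷ ○ ∷ ○ ∷ ● ∷ ○ ∷ ● ∷ ● ∷ ○ ∷ ○ ∷ ○ ∷ []) ∷
    (○ ∷ ○ ∷ ● ∷ ● ∷ ○ ∷ ○ ∷ ● ∷ ○ ∷ ○ ∷ ○ ∷ ● ∷ ○ ∷ ● ∷ []) ∷
    (● ∷ ● ∷ ● ∷ ○ ∷ ● ∷ ● ∷ ○ ∷ ○ ∷ ● ∷ ○ ∷ ○ ∷ ● ∷ ○ ∷ []) ∷
    (● ∷ ○ ∷ ○ ∷ ● ∷ ○ ∷ ○ ∷ ○ ∷ ○ ∷ ○ ∷ ● ∷ ○ ∷ ● ∷ ● ∷ []) ∷
    (○ ∷ ● ∷ ○ ∷ ● ∷ ● ∷ ○ ∷ ● ∷ ○ ∷ ○ ∷ ● ∷ ● ∷ ○ ∷ ● ∷ []) ∷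
    (○ ∷ ○ ∷ ○ ∷ ● ∷ ● ∷ ○ ∷ ○ ∷ ● ∷ ● ∷ ○ ∷ ○ ∷ ● ∷ ○ ∷ []) ∷
    (○ ∷ ○ ∷ ● ∷ ● ∷ ○ ∷ ● ∷ ○ ∷ ○ ∷ ● ∷ ○ ∷ ○ ∷ ● ∷ ● ∷ []) ∷
    (● ∷ ○ ∷ ○ ∷ ○ ∷ ○ ∷ ○ ∷ ● ∷ ● ∷ ○ ∷ ● ∷ ● ∷ ○ ∷ ● ∷ []) ∷
    (○ ∷ ● ∷ ○ ∷ ● ∷ ○ ∷ ● ∷ ○ ∷ ● ∷ ● ∷ ○ ∷ ● ∷ ● ∷ ○ ∷ []) ∷
    [] ) _ _

dvo₈ : DuallyVertexOblique G₈
dvo₈ = from-yes (duallyVertexOblique? G₈)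

dvo₉ : DuallyVertexOblique G₉
dvo₉ = from-yes (duallyVertexOblique? G₉)

dvo₁₂ : DuallyVertexOblique G₁₂
dvo₁₂ = from-yes (duallyVertexOblique? G₁₂)

dvo₁₃ : DuallyVertexOblique G₁₃
dvo₁₃ = from-yes (duallyVertexOblique? G₁₃)

HasDVO : ℕ → Set
HasDVO n = ∃[ G ] DuallyVertexOblique {n} G

hasDVO-+8 : HasDVO n → HasDVO (8 + n)
hasDVO-+8 (G , dvo) = Glue.glue F₈ J₈ G , glue-duallyVertexOblique gadget₈ G dvo

hasDVO-8+4q : ∀ q → HasDVO (8 + q * 4)
hasDVO-8+4q zero = G₈ , dvo₈
hasDVO-8+4q (suc zero) = G₁₂ , dvo₁₂
hasDVO-8+4q (suc (suc q)) = hasDVO-+8 (hasDVO-8+4q q)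

hasDVO-9+4q : ∀ q → HasDVO (9 + q * 4)
hasDVO-9+4q zero = G₉ , dvo₉
hasDVO-9+4q (suc zero) = G₁₃ , dvo₁₃
hasDVO-9+4q (suc (suc q)) = hasDVO-+8 (hasDVO-9+4q q)

hasDVO-mod-4 : ∀ r q → r ≡ 0 ⊎ r ≡ 1 → 8 ≤ r + q * 4 → HasDVO (r + q * 4)
hasDVO-mod-4 _ (suc (suc q)) (inj₁ refl) _ = hasDVO-8+4q q
hasDVO-mod-4 _ (suc (suc q)) (inj₂ refl) _ = hasDVO-9+4q q
hasDVO-mod-4 _ zero (inj₁ refl) ()
hasDVO-mod-4 _ zero (inj₂ refl) (s≤s ())
hasDVO-mod-4 _ (suc zero) (inj₁ refl) (s≤s (s≤s (s≤s (s≤s ()))))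
hasDVO-mod-4 _ (suc zero) (inj₂ refl) (s≤s (s≤s (s≤s (s≤s (s≤s ())))))

small-orders-excluded : ∀ n → 1 < n → n % 4 ≡ 0 ⊎ n % 4 ≡ 1 → ¬ (n ≡ 4 ⊎ n ≡ 5) → 8 ≤ n
small-orders-excluded 0 () _ _
small-orders-excluded 1 (s≤s ()) _ _
small-orders-excluded 2 _ (inj₁ ()) _
small-orders-excluded 2 _ (inj₂ ()) _
small-orders-excluded 3 _ (inj₁ ()) _
small-orders-excluded 3 _ (inj₂ ()) _
small-orders-excluded 4 _ _ n∉45 = ⊥-elim (n∉45 (inj₁ refl))
small-orders-excluded 5 _ _ n∉45 = ⊥-elim (n∉45 (inj₂ refl))
small-orders-excluded 6 _ (inj₁ ()) _
small-orders-excluded 6 _ (inj₂ ()) _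
small-orders-excluded 7 _ (inj₁ ()) _
small-orders-excluded 7 _ (inj₂ ()) _
small-orders-excluded (suc (suc (suc (suc (suc (suc (suc (suc _)))))))) _ _ _ =
  s≤s (s≤s (s≤s (s≤s (s≤s (s≤s (s≤s (s≤s z≤n)))))))

theorem1 : ∀ (n : ℕ) → 1 < n →
    ((∃[ G ] DuallyVertexOblique {n} G) ⇔ (((n % 4 ≡ 0) ⊎ (n % 4 ≡ 1)) × 8 ≤ n))
theorem1 n 1<n = mk⇔ necessary sufficient
  where
  necessary : ∃[ G ] DuallyVertexOblique G → (n % 4 ≡ 0 ⊎ n % 4 ≡ 1) × 8 ≤ n
  necessary (G , dvo) = dvo⇒mod-4 G dvo ,
    small-orders-excluded n 1<n (dvo⇒mod-4 G dvo) (λ n∈45 → no-vertexOblique n∈45 G (proj₁ dvo))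
  sufficient : (n % 4 ≡ 0 ⊎ n % 4 ≡ 1) × 8 ≤ n → ∃[ G ] DuallyVertexOblique G
  sufficient (r∈01 , 8≤n) = subst HasDVO (≡-sym n≡r+4q)
    (hasDVO-mod-4 (n % 4) (n / 4) r∈01 (subst (8 ≤_) n≡r+4q 8≤n))
    where
    n≡r+4q : n ≡ n % 4 + n / 4 * 4
    n≡r+4q = m≡m%n+[m/n]*n n 4
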